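{- Let $G$ be an oriented graph on $n$ vertices and let $k$ be a positive integer such that $G$ contains no directed path of length $k$. Then there is an ordering $x_1,\ldots,x_n$ of the vertex set of $G$ such that for every $i\in\{1,\ldots,n\}$, $|N^{ - }(x_i)\cap\{x_{i+1},\ldots,x_n\}|\le k-1$.
   Context: An oriented graph is a directed graph with no loops, no multiple edges and at most one edge between any two vertices. The length of a directed path is its number of edges. $N^{ - }(x)$ denotes the set of in-neighbours of $x$, i.e. vertices $y$ with an edge oriented from $y$ to $x$. -}

module Defs where

open import Data.Nat using (ℕ; suc; _≤_; _∸_)
open import Data.Fin using (Fin; _<_; _<?_; inject₁; suc)
open import Data.Fin.Subset using (Subset; ∣_∣)
open import Data.Vec using (tabulate)
open import Data.Bool using (Bool)
open import Data.Product using (Σ; _×_)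
open import Function.Bundles using (_↔_; Inverse)
open import Function.Definitions using (Injective)
open import Relation.Binary.PropositionalEquality using (_≡_)
open import Relation.Nullary using (¬_; Dec)
open import Relation.Nullary.Decidable using (⌊_⌋; _×-dec_)
open import Level using (0ℓ)

-- An oriented graph on vertex set Fin n: E x y means an edge oriented x → y.
-- Edge relation is decidable (finite graph), needed to count neighbours.
record OrientedGraph (n : ℕ) : Set₁ where
  field
    E      : Fin n → Fin n → Set
    E?     : (x y : Fin n) → Dec (E x y)
    irrefl : (x : Fin n) → ¬ E x x
    asym   : (x y : Fin n) → E x y → ¬ E y x

open OrientedGraph public

DirectedPath : {n : ℕ} → OrientedGraph n → ℕ → Set
DirectedPath {n} G k =
  Σ (Fin (suc k) → Fin n) λ p →
    Injective _≡_ _≡_ p ×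
    ((i : Fin k) → E G (p (inject₁ i)) (p (suc i)))

-- Given an ordering σ (σ i = x_i), the set N⁻(x_i) ∩ {x_{i+1},…,x_n},
-- represented as the subset of positions j with i < j and x_j → x_i.
laterInNbrs : {n : ℕ} → (G : OrientedGraph n) → (Fin n → Fin n) → Fin n → Subset n
laterInNbrs G σ i =
  tabulate λ j → ⌊ (i <? j) ×-dec (E? G (σ j) (σ i)) ⌋

module Submission where

-- Starting from a single vertex, keep prepending an in-neighbour of the first vertex that
-- is not yet on the path. Without directed paths of length k this stops at a path of
-- length at most k − 1 whose first vertex v has all its in-neighbours on the path, so v
-- has in-degree at most k − 1. Put v first and order G − v recursively: v precedes
-- everything, so later positions see the same in-neighbours as in the ordering of G − v.

open import Defs
open import Data.Nat using (ℕ; zero; suc; _+_; _≤_; _∸_; _>_; z≤n; s≤s; s≤s⁻¹; _≤‴_; ≤‴-refl; ≤‴-step)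
open import Data.Nat.Properties using (≤-trans; ≤-reflexive; m≤n⇒m≤1+n; +-suc; ≤⇒≤‴; ≤‴⇒≤)
open import Data.Fin using (Fin; zero; suc; inject₁; punchIn; _≟_; _<?_)
open import Data.Fin.Properties using (any?; punchIn-injective)
open import Data.Fin.Subset using (Subset; inside; outside; _∈_; _⊆_; _∪_; ⁅_⁆; ⊥; ∣_∣)
open import Data.Fin.Subset.Properties using (∣⊥∣≡0; ∣⁅x⁆∣≡1; x∈⁅x⁆; x∈p∪q⁺; p⊆q⇒∣p∣≤∣q∣)
open import Data.Fin.Permutation using (Permutation′; _⟨$⟩ʳ_; _⟨$⟩ˡ_; inverseˡ; insert; insert-punchIn)
import Data.Fin.Permutation as Permutation
open import Data.Vec using ([]; _∷_; tabulate)
open import Data.Vec.Properties using ([]=⇒lookup; lookup∘tabulate; tabulate-cong)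
import Data.Vec.Functional as Vector
open import Data.Bool using (Bool; _∧_; T)
open import Data.Bool.Properties using (T-≡)
open import Data.Product using (Σ; _×_; _,_; ∃; proj₁; proj₂)
open import Data.Sum using (_⊎_; inj₁; inj₂)
open import Data.Empty using (⊥-elim)
open import Function using (_∘_)
open import Function.Bundles using (_↔_; Inverse; Equivalence; mk⇔)
open import Function.Definitions using (Injective)
open import Relation.Binary.PropositionalEquality
  using (_≡_; _≢_; refl; sym; trans; cong; cong₂; subst; module ≡-Reasoning)
open import Relation.Nullary using (¬_; yes; no; ¬?; does)
open import Relation.Nullary.Decidable using (⌊_⌋; _×-dec_; toWitness; does-⇔; isYes≗does)

∣p∪q∣≤∣p∣+∣q∣ : ∀ {n} (p q : Subset n) → ∣ p ∪ q ∣ ≤ ∣ p ∣ + ∣ q ∣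
∣p∪q∣≤∣p∣+∣q∣ []            []            = z≤n
∣p∪q∣≤∣p∣+∣q∣ (inside  ∷ p) (outside ∷ q) = s≤s (∣p∪q∣≤∣p∣+∣q∣ p q)
∣p∪q∣≤∣p∣+∣q∣ (inside  ∷ p) (inside  ∷ q) =
  s≤s (subst (∣ p ∪ q ∣ ≤_) (sym (+-suc ∣ p ∣ ∣ q ∣)) (m≤n⇒m≤1+n (∣p∪q∣≤∣p∣+∣q∣ p q)))
∣p∪q∣≤∣p∣+∣q∣ (outside ∷ p) (outside ∷ q) = ∣p∪q∣≤∣p∣+∣q∣ p q
∣p∪q∣≤∣p∣+∣q∣ (outside ∷ p) (inside  ∷ q) =
  subst (suc ∣ p ∪ q ∣ ≤_) (sym (+-suc ∣ p ∣ ∣ q ∣)) (s≤s (∣p∪q∣≤∣p∣+∣q∣ p q))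

image : ∀ {ℓ n} → (Fin ℓ → Fin n) → Subset n
image {zero}  q = ⊥
image {suc ℓ} q = ⁅ q zero ⁆ ∪ image (q ∘ suc)

∣image∣≤ℓ : ∀ {ℓ n} (q : Fin ℓ → Fin n) → ∣ image q ∣ ≤ ℓ
∣image∣≤ℓ {zero} {n} q = ≤-reflexive (∣⊥∣≡0 n)
∣image∣≤ℓ {suc ℓ} q = ≤-trans (∣p∪q∣≤∣p∣+∣q∣ ⁅ q zero ⁆ (image (q ∘ suc)))
  (subst (λ c → c + ∣ image (q ∘ suc) ∣ ≤ suc ℓ) (sym (∣⁅x⁆∣≡1 (q zero)))
         (s≤s (∣image∣≤ℓ (q ∘ suc))))

∈image : ∀ {ℓ n} (q : Fin ℓ → Fin n) (i : Fin ℓ) → q i ∈ image q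
∈image q zero    = x∈p∪q⁺ (inj₁ (x∈⁅x⁆ (q zero)))
∈image q (suc i) = x∈p∪q⁺ (inj₂ (∈image (q ∘ suc) i))

∈tabulate⇒T : ∀ {n} {f : Fin n → Bool} {j : Fin n} → j ∈ tabulate f → T (f j)
∈tabulate⇒T {f = f} {j} j∈ =
  Equivalence.from T-≡ (trans (sym (lookup∘tabulate f j)) ([]=⇒lookup j∈))

module _ {n : ℕ} (G : OrientedGraph n) where

  InNbrsAmong : ∀ {ℓ} → Fin n → (Fin ℓ → Fin n) → Set
  InNbrsAmong v q = ∀ u → E G u v → ∃ λ i → q i ≡ u

  record LowInDegreeVertex (k : ℕ) : Set where
    field
      vertex : Fin n
      {size} : ℕ
      size≤k : size ≤ k
      among  : Fin size → Fin n
      covers : InNbrsAmong vertex among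

  trivialPath : Fin n → DirectedPath G 0
  trivialPath x = (λ _ → x) , (λ { {zero} {zero} _ → refl }) , λ ()

  prepend : ∀ {ℓ} (P : DirectedPath G ℓ) (u : Fin n) → let p = proj₁ P in
            E G u (p zero) → (∀ i → u ≢ p i) → DirectedPath G (suc ℓ)
  prepend (p , inj , edges) u u→p₀ u∉p = u Vector.∷ p , inj′ , edges′
    where
    inj′ : Injective _≡_ _≡_ (u Vector.∷ p)
    inj′ {zero}  {zero}  _  = refl
    inj′ {zero}  {suc j} eq = ⊥-elim (u∉p j eq)
    inj′ {suc i} {zero}  eq = ⊥-elim (u∉p i (sym eq))
    inj′ {suc i} {suc j} eq = cong suc (inj eq)
    edges′ : ∀ i → E G ((u Vector.∷ p) (inject₁ i)) ((u Vector.∷ p) (suc i))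
    edges′ zero    = u→p₀
    edges′ (suc i) = edges i

  prependable⊎inNbrsOnPath : ∀ {ℓ} (P : DirectedPath G ℓ) → let p = proj₁ P in
    (∃ λ u → E G u (p zero) × ∀ i → u ≢ p i) ⊎ InNbrsAmong (p zero) (p ∘ suc)
  prependable⊎inNbrsOnPath (p , _) with any? (λ u → E? G u (p zero) ×-dec ¬? (any? λ i → u ≟ p i))
  ... | yes (u , u→p₀ , u∉p) = inj₁ (u , u→p₀ , λ i eq → u∉p (i , eq))
  ... | no noneOff = inj₂ onPath
    where
    onPath : InNbrsAmong (p zero) (p ∘ suc)
    onPath u u→p₀ with any? (λ i → u ≟ p i)
    ... | yes (zero  , refl) = ⊥-elim (irrefl G u u→p₀)
    ... | yes (suc i , refl) = i , refl
    ... | no  u∉p            = ⊥-elim (noneOff (u , u→p₀ , u∉p))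

  -- Each prepend consumes one ≤‴-step, so the backward growth is structural recursion.
  lowInDegreeVertex : ∀ {k ℓ} → ¬ DirectedPath G (suc k) → ℓ ≤‴ k → DirectedPath G ℓ →
                      LowInDegreeVertex k
  lowInDegreeVertex noPath ℓ≤k P with prependable⊎inNbrsOnPath P
  ... | inj₂ covered = record { size≤k = ≤‴⇒≤ ℓ≤k ; covers = covered }
  ... | inj₁ (u , u→p₀ , u∉p) with ℓ≤k
  ...   | ≤‴-refl     = ⊥-elim (noPath (prepend P u u→p₀ u∉p))
  ...   | ≤‴-step ℓ<k = lowInDegreeVertex noPath ℓ<k (prepend P u u→p₀ u∉p)

removeVertex : ∀ {m} → OrientedGraph (suc m) → Fin (suc m) → OrientedGraph m
removeVertex G v = record
  { E      = λ x y → E G (punchIn v x) (punchIn v y)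
  ; E?     = λ x y → E? G (punchIn v x) (punchIn v y)
  ; irrefl = λ x → irrefl G (punchIn v x)
  ; asym   = λ x y → asym G (punchIn v x) (punchIn v y)
  }

pathOfRemoveVertex : ∀ {m k} (G : OrientedGraph (suc m)) (v : Fin (suc m)) →
                     DirectedPath (removeVertex G v) k → DirectedPath G k
pathOfRemoveVertex G v (p , inj , edges) =
  punchIn v ∘ p , inj ∘ punchIn-injective v _ _ , edges

∈laterInNbrs⇒edge : ∀ {n} (G : OrientedGraph n) (σ : Fin n → Fin n) {i j : Fin n} →
                    j ∈ laterInNbrs G σ i → E G (σ j) (σ i)
∈laterInNbrs⇒edge G σ {i} {j} j∈ =
  proj₂ (toWitness {a? = (i <? j) ×-dec E? G (σ j) (σ i)} (∈tabulate⇒T j∈))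

inNbrsAmong⇒∣laterInNbrs∣≤ : ∀ {n ℓ} (G : OrientedGraph n) (σ : Permutation′ n) (i : Fin n)
  (q : Fin ℓ → Fin n) → InNbrsAmong G (σ ⟨$⟩ʳ i) q → ∣ laterInNbrs G (σ ⟨$⟩ʳ_) i ∣ ≤ ℓ
inNbrsAmong⇒∣laterInNbrs∣≤ {n} {ℓ} G σ i q covered =
  ≤-trans (p⊆q⇒∣p∣≤∣q∣ later⊆image) (∣image∣≤ℓ positions)
  where
  positions : Fin ℓ → Fin n
  positions = (σ ⟨$⟩ˡ_) ∘ q
  later⊆image : laterInNbrs G (σ ⟨$⟩ʳ_) i ⊆ image positions
  later⊆image {j} j∈ with covered (σ ⟨$⟩ʳ j) (∈laterInNbrs⇒edge G (σ ⟨$⟩ʳ_) j∈)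
  ... | a , qa≡σj =
    subst (_∈ image positions) (trans (cong (σ ⟨$⟩ˡ_) qa≡σj) (inverseˡ σ)) (∈image positions a)

laterInNbrs-insert-suc : ∀ {m} (G : OrientedGraph (suc m)) (v : Fin (suc m)) (π : Permutation′ m)
  (i : Fin m) → laterInNbrs G (insert zero v π ⟨$⟩ʳ_) (suc i)
                ≡ outside ∷ laterInNbrs (removeVertex G v) (π ⟨$⟩ʳ_) i
laterInNbrs-insert-suc {m} G v π i = cong (outside ∷_) (tabulate-cong λ j → begin
  ⌊ (suc i <? suc j) ×-dec E? G (σ (suc j)) (σ (suc i)) ⌋            ≡⟨ isYes≗does _ ⟩
  does (suc i <? suc j) ∧ does (E? G (σ (suc j)) (σ (suc i)))        ≡⟨ cong₂ _∧_
    (does-⇔ (mk⇔ s≤s⁻¹ s≤s) (suc i <? suc j) (i <? j))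
    (cong₂ (λ x y → does (E? G x y)) (insert-punchIn zero v π j) (insert-punchIn zero v π i)) ⟩
  does (i <? j) ∧ does (E? G (punchIn v (π ⟨$⟩ʳ j)) (punchIn v (π ⟨$⟩ʳ i))) ≡⟨ isYes≗does _ ⟨
  ⌊ (i <? j) ×-dec E? G (punchIn v (π ⟨$⟩ʳ j)) (punchIn v (π ⟨$⟩ʳ i)) ⌋ ∎)
  where
  open ≡-Reasoning
  σ : Fin (suc m) → Fin (suc m)
  σ = insert zero v π ⟨$⟩ʳ_

orderingWithFewLaterInNbrs : ∀ k {n} (G : OrientedGraph n) → ¬ DirectedPath G (suc k) →
  Σ (Permutation′ n) λ σ → ∀ i → ∣ laterInNbrs G (σ ⟨$⟩ʳ_) i ∣ ≤ k
orderingWithFewLaterInNbrs k {zero}  G noPath = Permutation.id , λ ()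
orderingWithFewLaterInNbrs k {suc m} G noPath = insert zero vertex π , bound
  where
  open LowInDegreeVertex (lowInDegreeVertex G noPath (≤⇒≤‴ z≤n) (trivialPath G zero))
  rest : Σ (Permutation′ m) λ π → ∀ i → ∣ laterInNbrs (removeVertex G vertex) (π ⟨$⟩ʳ_) i ∣ ≤ k
  rest = orderingWithFewLaterInNbrs k (removeVertex G vertex) (noPath ∘ pathOfRemoveVertex G vertex)
  π : Permutation′ m
  π = proj₁ rest
  bound : ∀ i → ∣ laterInNbrs G (insert zero vertex π ⟨$⟩ʳ_) i ∣ ≤ k
  bound zero    =
    ≤-trans (inNbrsAmong⇒∣laterInNbrs∣≤ G (insert zero vertex π) zero among covers) size≤k
  bound (suc i) =
    subst (_≤ k) (sym (cong ∣_∣ (laterInNbrs-insert-suc G vertex π i))) (proj₂ rest i)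

lemma1 : (n : ℕ) (G : OrientedGraph n) (k : ℕ) → k > 0 →
    ¬ DirectedPath G k →
    Σ (Fin n ↔ Fin n) λ σ →
      (i : Fin n) → ∣ laterInNbrs G (Inverse.to σ) i ∣ ≤ k ∸ 1
lemma1 n G (suc k) _ noPath = orderingWithFewLaterInNbrs k G noPath
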